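{- For every integer $n\ge 2$, $C(n)\ge \exp\left(\sum_{i=2}^{n}\frac{A(i)}{i}\right)$.
   Context: A $2$-coloring of the edges of a complete graph assigns to each edge one of two colors, red or blue. A monochromatic complete subgraph is a set $S$ of vertices (including the empty set and single vertices) such that all edges with both endpoints in $S$ have the same color; they are counted as vertex sets, each set once, and the size of $S$ is $|S|$. $A(n)$ is the minimum, over all $2$-colorings of the edges of the complete graph on $n$ vertices, of the average size of a monochromatic complete subgraph; $C(n)$ is the minimum, over all such $2$-colorings, of the number of monochromatic complete subgraphs. -}

module Defs where

open import Data.Bool using (Bool; true; false; _∧_; _∨_; not; if_then_else_)
open import Data.Bool.Properties using () renaming (_≟_ to _≟ᵇ_)
open import Data.Nat as ℕ using (ℕ; zero; suc; _<ᵇ_)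
open import Data.Nat using (_!)
open import Data.Fin using (Fin; toℕ)
open import Data.List using (List; []; _∷_; map; concatMap; filter; length; foldr; allFin)
open import Data.Bool.ListAction using (and)
open import Data.Integer using (+_)
open import Data.Rational as ℚ using (ℚ; 0ℚ; 1ℚ; _/_; _+_; _*_; _⊓_)
open import Relation.Nullary.Decidable using (does)

funs : {B : Set} → List B → (n : ℕ) → List (Fin n → B)
funs bs zero = (λ ()) ∷ []
funs bs (suc n) = concatMap (λ b → map (λ f → λ { Fin.zero → b ; (Fin.suc i) → f i }) (funs bs n)) bs

bools : List Bool
bools = true ∷ false ∷ []

-- A 2-colouring of the edges of K_n (vertex set Fin n): the colour of the
-- edge {i,j} with toℕ i < toℕ j is c i j (true = red, false = blue);
-- entries with toℕ i ≥ toℕ j are ignored.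
Coloring : ℕ → Set
Coloring n = Fin n → Fin n → Bool

allColorings : (n : ℕ) → List (Coloring n)
allColorings n = funs (funs bools n) n

Subset : ℕ → Set
Subset n = Fin n → Bool

allSubsets : (n : ℕ) → List (Subset n)
allSubsets n = funs bools n

data Pair (n : ℕ) : Set where
  pr : Fin n → Fin n → Pair n

edges : (n : ℕ) → List (Pair n)
edges n = concatMap (λ i → concatMap (λ j → if toℕ i <ᵇ toℕ j then pr i j ∷ [] else []) (allFin n)) (allFin n)

monoIn : {n : ℕ} → Coloring n → Bool → Subset n → Bool
monoIn {n} c b S = and (map (λ { (pr i j) → not (S i ∧ S j) ∨ does (c i j ≟ᵇ b) }) (edges n))

-- S spans a monochromatic complete subgraph (∅ and singletons included)
isMono : {n : ℕ} → Coloring n → Subset n → Bool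
isMono c S = monoIn c true S ∨ monoIn c false S

size : {n : ℕ} → Subset n → ℕ
size {n} S = length (filter (λ i → S i ≟ᵇ true) (allFin n))

monoSets : {n : ℕ} → Coloring n → List (Subset n)
monoSets {n} c = filter (λ S → isMono c S ≟ᵇ true) (allSubsets n)

numMono : {n : ℕ} → Coloring n → ℕ
numMono c = length (monoSets c)

totalMono : {n : ℕ} → Coloring n → ℕ
totalMono c = foldr ℕ._+_ 0 (map size (monoSets c))

-- t / k as a rational (k ≥ 1 always holds here since ∅ is monochromatic)
ratio : ℕ → ℕ → ℚ
ratio t zero = 0ℚ
ratio t (suc k) = (+ t) / suc k

avgMono : {n : ℕ} → Coloring n → ℚ
avgMono c = ratio (totalMono c) (numMono c)

minℕ : List ℕ → ℕ
minℕ [] = 0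
minℕ (x ∷ xs) = foldr ℕ._⊓_ x xs

minℚ : List ℚ → ℚ
minℚ [] = 0ℚ
minℚ (x ∷ xs) = foldr _⊓_ x xs

A : ℕ → ℚ
A n = minℚ (map avgMono (allColorings n))

C : ℕ → ℕ
C n = minℕ (map numMono (allColorings n))

fromℕ : ℕ → ℚ
fromℕ m = (+ m) / 1

_^_ : ℚ → ℕ → ℚ
q ^ zero = 1ℚ
q ^ suc k = q * (q ^ k)

-- Σ_{i=a}^{b} f i computed as Σ over i = a, a+1, …, a+len-1
sumFrom : ℕ → ℕ → (ℕ → ℚ) → ℚ
sumFrom a zero f = 0ℚ
sumFrom a (suc len) f = f a + sumFrom (suc a) len f

-- Σ_{i=2}^{n} A(i)/i   (for n ≥ 2; the range has n ∸ 1 terms)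
S : ℕ → ℚ
S n = sumFrom 2 (n ℕ.∸ 1) (λ i → A i * ratio 1 i)

expPartial : ℚ → ℕ → ℚ
expPartial x K = sumFrom 0 (suc K) (λ j → (x ^ j) * ratio 1 (j !))

-- exp x ≤ y, for x ≥ 0: every Taylor partial sum of exp x (an increasing
-- sequence with supremum exp x) is ≤ y.
ExpLe : ℚ → ℚ → Set
ExpLe x y = (K : ℕ) → expPartial x K ℚ.≤ y

module Submission where

-- Deleting a vertex v from a colouring c of K_n leaves a colouring of K_{n−1}; its monochromatic sets
-- are exactly the monochromatic sets of c avoiding v, so there are at least C(n−1) of them. Summed
-- over v, each monochromatic set S of c is counted n − |S| times, whence n·C(n−1) ≤ n·N(c) − T(c)
-- ≤ N(c)(n − A(n)), with N(c) and T(c) the number and total size of the monochromatic sets of c.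
-- For a minimising c this reads C(n−1) ≤ C(n)(1 − A(n)/n). Starting from C(1) ≥ 1, it then suffices
-- that exp(x + y) ≤ exp(x)/(1 − y) for x ≥ 0 and 0 ≤ y < 1. On Taylor partial sums E_K this follows
-- from the mean value bound (x + y)^(m+1) ≤ x^(m+1) + (m+1)·y·(x + y)^m, which gives
-- E_{K+1}(x + y) ≤ E_{K+1}(x) + y·E_K(x + y) and hence E_K(x + y)·(1 − y) ≤ E_K(x).

open import Defs

module ExpBounds where
  open import Data.Nat as ℕ using (ℕ; zero; suc; _!)
  import Data.Nat.Properties as ℕ
  import Data.Integer as ℤ
  import Data.Integer.Properties as ℤ
  open import Data.Rational as ℚ using (ℚ; 0ℚ; 1ℚ; _+_; _*_; _-_; _≤_; _<_; fromℚᵘ; nonNegative; positive)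
  import Data.Rational.Properties as ℚ
  open import Data.Rational.Unnormalised as ℚᵘ using (mkℚᵘ; *≡*; *≤*)
  import Data.Rational.Unnormalised.Properties as ℚᵘ
  open import Data.Rational.Solver using (module +-*-Solver)
  open import Relation.Binary.PropositionalEquality

  fromℚᵘ-homo-+ : ∀ p q → fromℚᵘ (p ℚᵘ.+ q) ≡ fromℚᵘ p + fromℚᵘ q
  fromℚᵘ-homo-+ p q = ℚ.toℚᵘ-injective (ℚᵘ.≃-trans (ℚ.toℚᵘ-fromℚᵘ _) (ℚᵘ.≃-sym (ℚᵘ.≃-trans
    (ℚ.toℚᵘ-homo-+ (fromℚᵘ p) (fromℚᵘ q)) (ℚᵘ.+-cong (ℚ.toℚᵘ-fromℚᵘ p) (ℚ.toℚᵘ-fromℚᵘ q)))))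

  fromℚᵘ-homo-* : ∀ p q → fromℚᵘ (p ℚᵘ.* q) ≡ fromℚᵘ p * fromℚᵘ q
  fromℚᵘ-homo-* p q = ℚ.toℚᵘ-injective (ℚᵘ.≃-trans (ℚ.toℚᵘ-fromℚᵘ _) (ℚᵘ.≃-sym (ℚᵘ.≃-trans
    (ℚ.toℚᵘ-homo-* (fromℚᵘ p) (fromℚᵘ q)) (ℚᵘ.*-cong (ℚ.toℚᵘ-fromℚᵘ p) (ℚ.toℚᵘ-fromℚᵘ q)))))

  fromℚᵘ-mono-≤ : ∀ {p q} → p ℚᵘ.≤ q → fromℚᵘ p ≤ fromℚᵘ q
  fromℚᵘ-mono-≤ {p} {q} p≤q = ℚ.toℚᵘ-cancel-≤
    (ℚᵘ.≤-respˡ-≃ (ℚᵘ.≃-sym (ℚ.toℚᵘ-fromℚᵘ p)) (ℚᵘ.≤-respʳ-≃ (ℚᵘ.≃-sym (ℚ.toℚᵘ-fromℚᵘ q)) p≤q))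

  fromℕ-+ : ∀ a b → fromℕ (a ℕ.+ b) ≡ fromℕ a + fromℕ b
  fromℕ-+ a b = trans
    (ℚ.fromℚᵘ-cong {mkℚᵘ (ℤ.+ (a ℕ.+ b)) 0} {mkℚᵘ (ℤ.+ a) 0 ℚᵘ.+ mkℚᵘ (ℤ.+ b) 0} (*≡* (trans (ℤ.*-identityʳ _)
      (trans (ℤ.pos-+ a b) (sym (trans (ℤ.*-identityʳ _) (cong₂ ℤ._+_ (ℤ.*-identityʳ (ℤ.+ a)) (ℤ.*-identityʳ (ℤ.+ b)))))))))
    (fromℚᵘ-homo-+ (mkℚᵘ (ℤ.+ a) 0) (mkℚᵘ (ℤ.+ b) 0))

  fromℕ-* : ∀ a b → fromℕ (a ℕ.* b) ≡ fromℕ a * fromℕ b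
  fromℕ-* a b = trans
    (ℚ.fromℚᵘ-cong {mkℚᵘ (ℤ.+ (a ℕ.* b)) 0} {mkℚᵘ (ℤ.+ a) 0 ℚᵘ.* mkℚᵘ (ℤ.+ b) 0} (*≡* (cong (ℤ._* ℤ.+ 1) (ℤ.pos-* a b))))
    (fromℚᵘ-homo-* (mkℚᵘ (ℤ.+ a) 0) (mkℚᵘ (ℤ.+ b) 0))

  fromℕ-mono-≤ : ∀ {a b} → a ℕ.≤ b → fromℕ a ≤ fromℕ b
  fromℕ-mono-≤ {a} {b} a≤b = fromℚᵘ-mono-≤ {mkℚᵘ (ℤ.+ a) 0} {mkℚᵘ (ℤ.+ b) 0}
    (*≤* (subst₂ ℤ._≤_ (sym (ℤ.*-identityʳ (ℤ.+ a))) (sym (ℤ.*-identityʳ (ℤ.+ b))) (ℤ.+≤+ a≤b)))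

  fromℕ-nonNeg : ∀ a → 0ℚ ≤ fromℕ a
  fromℕ-nonNeg a = ℚ.nonNegative⁻¹ _ {{ℚ.normalize-nonNeg a 1}}

  fromℕ-pos : ∀ d .{{_ : ℕ.NonZero d}} → 0ℚ < fromℕ d
  fromℕ-pos d = ℚ.positive⁻¹ _ {{ℚ.normalize-pos d 1}}

  ratio-nonNeg : ∀ t d → 0ℚ ≤ ratio t d
  ratio-nonNeg t zero    = ℚ.≤-refl
  ratio-nonNeg t (suc k) = ℚ.nonNegative⁻¹ _ {{ℚ.normalize-nonNeg t (suc k)}}

  ratio-*-cancel : ∀ t d .{{_ : ℕ.NonZero d}} → ratio t d * fromℕ d ≡ fromℕ t
  ratio-*-cancel t (suc k) = trans (sym (fromℚᵘ-homo-* (mkℚᵘ (ℤ.+ t) k) (mkℚᵘ (ℤ.+ suc k) 0)))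
    (ℚ.fromℚᵘ-cong {mkℚᵘ (ℤ.+ t) k ℚᵘ.* mkℚᵘ (ℤ.+ suc k) 0} {mkℚᵘ (ℤ.+ t) 0}
      (*≡* (trans (ℤ.*-identityʳ _) (cong (λ d → ℤ.+ t ℤ.* ℤ.+ suc d) (sym (ℕ.*-identityʳ k))))))

  *-cancelʳ-≡-pos : ∀ {p q} r → 0ℚ < r → p * r ≡ q * r → p ≡ q
  *-cancelʳ-≡-pos r r>0 pr≡qr = ℚ.≤-antisym (cancel (ℚ.≤-reflexive pr≡qr)) (cancel (ℚ.≤-reflexive (sym pr≡qr)))
    where
    cancel : ∀ {p q} → p * r ≤ q * r → p ≤ q
    cancel = ℚ.*-cancelʳ-≤-pos r {{positive r>0}}

  ratio-1-! : ∀ m → ratio 1 (suc m !) * fromℕ (suc m) ≡ ratio 1 (m !)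
  ratio-1-! m = *-cancelʳ-≡-pos (fromℕ (m !)) (fromℕ-pos (m !) {{ℕ._!≢0 m}}) (begin
    ratio 1 (suc m !) * fromℕ (suc m) * fromℕ (m !)   ≡⟨ ℚ.*-assoc (ratio 1 (suc m !)) _ _ ⟩
    ratio 1 (suc m !) * (fromℕ (suc m) * fromℕ (m !)) ≡⟨ cong (ratio 1 (suc m !) *_) (fromℕ-* (suc m) (m !)) ⟨
    ratio 1 (suc m !) * fromℕ (suc m !)               ≡⟨ ratio-*-cancel 1 (suc m !) {{ℕ._!≢0 (suc m)}} ⟩
    fromℕ 1                                           ≡⟨ ratio-*-cancel 1 (m !) {{ℕ._!≢0 m}} ⟨
    ratio 1 (m !) * fromℕ (m !)                       ∎)
    where open ≡-Reasoning

  *-nonNeg : ∀ {p q} → 0ℚ ≤ p → 0ℚ ≤ q → 0ℚ ≤ p * q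
  *-nonNeg {p} {q} p≥0 q≥0 =
    ℚ.nonNegative⁻¹ (p * q) {{ℚ.nonNeg*nonNeg⇒nonNeg p {{nonNegative p≥0}} q {{nonNegative q≥0}}}}

  ^-nonNeg : ∀ {z} j → 0ℚ ≤ z → 0ℚ ≤ z ^ j
  ^-nonNeg zero    z≥0 = ℚ.<⇒≤ (ℚ.positive⁻¹ 1ℚ)
  ^-nonNeg (suc j) z≥0 = *-nonNeg z≥0 (^-nonNeg j z≥0)

  ^-mono-≤ : ∀ {x z} j → 0ℚ ≤ x → x ≤ z → x ^ j ≤ z ^ j
  ^-mono-≤         zero    x≥0 x≤z = ℚ.≤-refl
  ^-mono-≤ {x} {z} (suc j) x≥0 x≤z = ℚ.≤-trans
    (ℚ.*-monoʳ-≤-nonNeg (x ^ j) {{nonNegative (^-nonNeg j x≥0)}} x≤z)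
    (ℚ.*-monoˡ-≤-nonNeg z {{nonNegative (ℚ.≤-trans x≥0 x≤z)}} (^-mono-≤ j x≥0 x≤z))

  [x+y]^[1+m]-≤ : ∀ {x y} m → 0ℚ ≤ x → 0ℚ ≤ y →
                  (x + y) ^ suc m ≤ x ^ suc m + fromℕ (suc m) * (y * (x + y) ^ m)
  [x+y]^[1+m]-≤ {x} {y} zero x≥0 y≥0 = ℚ.≤-reflexive
    (solve 2 (λ x y → (x :+ y) :* con 1ℚ := x :* con 1ℚ :+ con 1ℚ :* (y :* con 1ℚ)) refl x y)
    where open +-*-Solver
  [x+y]^[1+m]-≤ {x} {y} (suc m) x≥0 y≥0 = begin
    z * z ^ suc m
      ≤⟨ ℚ.*-monoˡ-≤-nonNeg z {{nonNegative z≥0}} ([x+y]^[1+m]-≤ m x≥0 y≥0) ⟩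
    z * (x ^ suc m + k * (y * z ^ m))
      ≡⟨ solve 5 (λ x y p q k → (x :+ y) :* (p :+ k :* (y :* q)) := x :* p :+ y :* p :+ k :* (y :* ((x :+ y) :* q)))
                 refl x y (x ^ suc m) (z ^ m) k ⟩
    x ^ suc (suc m) + y * x ^ suc m + k * (y * z ^ suc m)
      ≤⟨ ℚ.+-monoˡ-≤ (k * (y * z ^ suc m)) (ℚ.+-monoʳ-≤ (x ^ suc (suc m))
           (ℚ.*-monoˡ-≤-nonNeg y {{nonNegative y≥0}} (^-mono-≤ (suc m) x≥0 x≤z))) ⟩
    x ^ suc (suc m) + y * z ^ suc m + k * (y * z ^ suc m)
      ≡⟨ solve 3 (λ p w k → p :+ w :+ k :* w := p :+ (con 1ℚ :+ k) :* w) refl (x ^ suc (suc m)) (y * z ^ suc m) k ⟩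
    x ^ suc (suc m) + (1ℚ + k) * (y * z ^ suc m)
      ≡⟨ cong (λ k′ → x ^ suc (suc m) + k′ * (y * z ^ suc m)) (fromℕ-+ 1 (suc m)) ⟨
    x ^ suc (suc m) + fromℕ (suc (suc m)) * (y * z ^ suc m) ∎
    where
    open ℚ.≤-Reasoning
    open +-*-Solver
    z k : ℚ
    z = x + y
    k = fromℕ (suc m)
    z≥0 : 0ℚ ≤ z
    z≥0 = ℚ.+-mono-≤ x≥0 y≥0
    x≤z : x ≤ z
    x≤z = ℚ.≤-trans (ℚ.≤-reflexive (sym (ℚ.+-identityʳ x))) (ℚ.+-monoʳ-≤ x y≥0)

  sumFrom-nonNeg : ∀ a n {f : ℕ → ℚ} → (∀ i → 0ℚ ≤ f i) → 0ℚ ≤ sumFrom a n f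
  sumFrom-nonNeg a zero    f≥0 = ℚ.≤-refl
  sumFrom-nonNeg a (suc n) f≥0 = ℚ.+-mono-≤ (f≥0 a) (sumFrom-nonNeg (suc a) n f≥0)

  sumFrom-≤-suc : ∀ a n {f : ℕ → ℚ} → (∀ i → 0ℚ ≤ f i) → sumFrom a n f ≤ sumFrom a (suc n) f
  sumFrom-≤-suc a zero        f≥0 = ℚ.≤-trans (f≥0 a) (ℚ.≤-reflexive (sym (ℚ.+-identityʳ _)))
  sumFrom-≤-suc a (suc n) {f} f≥0 = ℚ.+-monoʳ-≤ (f a) (sumFrom-≤-suc (suc a) n f≥0)

  sumFrom-snoc : ∀ a n f → sumFrom a (suc n) f ≡ sumFrom a n f + f (a ℕ.+ n)
  sumFrom-snoc a zero    f = trans (ℚ.+-comm (f a) 0ℚ) (cong (λ i → 0ℚ + f i) (sym (ℕ.+-identityʳ a)))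
  sumFrom-snoc a (suc n) f = begin
    f a + sumFrom (suc a) (suc n) f               ≡⟨ cong (f a +_) (sumFrom-snoc (suc a) n f) ⟩
    f a + (sumFrom (suc a) n f + f (suc a ℕ.+ n)) ≡⟨ ℚ.+-assoc (f a) _ _ ⟨
    f a + sumFrom (suc a) n f + f (suc a ℕ.+ n)   ≡⟨ cong (λ i → f a + sumFrom (suc a) n f + f i) (ℕ.+-suc a n) ⟨
    f a + sumFrom (suc a) n f + f (a ℕ.+ suc n)   ∎
    where open ≡-Reasoning

  sumFrom-suc-zero : ∀ a n {f : ℕ → ℚ} → (∀ i → f (suc i) ≡ 0ℚ) → sumFrom (suc a) n f ≡ 0ℚ
  sumFrom-suc-zero a zero    f≡0 = refl
  sumFrom-suc-zero a (suc n) f≡0 = trans (cong₂ _+_ (f≡0 a) (sumFrom-suc-zero (suc a) n f≡0)) (ℚ.+-identityˡ 0ℚ)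

  sumFrom-shift-≤ : ∀ a n {f g h : ℕ → ℚ} y → (∀ i → f (suc i) ≤ g (suc i) + y * h i) →
                    sumFrom (suc a) n f ≤ sumFrom (suc a) n g + y * sumFrom a n h
  sumFrom-shift-≤ a zero    y f≤g+yh = ℚ.≤-reflexive (sym (trans (ℚ.+-identityˡ _) (ℚ.*-zeroʳ y)))
  sumFrom-shift-≤ a (suc n) {f} {g} {h} y f≤g+yh = begin
    f (suc a) + sumFrom (suc (suc a)) n f
      ≤⟨ ℚ.+-mono-≤ (f≤g+yh a) (sumFrom-shift-≤ (suc a) n y f≤g+yh) ⟩
    (g (suc a) + y * h a) + (sumFrom (suc (suc a)) n g + y * sumFrom (suc a) n h)
      ≡⟨ solve 5 (λ g₀ y h₀ G H → (g₀ :+ y :* h₀) :+ (G :+ y :* H) := (g₀ :+ G) :+ y :* (h₀ :+ H))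
                 refl (g (suc a)) y (h a) _ _ ⟩
    sumFrom (suc a) (suc n) g + y * sumFrom a (suc n) h ∎
    where
    open ℚ.≤-Reasoning
    open +-*-Solver

  term : ℚ → ℕ → ℚ
  term z j = z ^ j * ratio 1 (j !)

  term-nonNeg : ∀ {z} j → 0ℚ ≤ z → 0ℚ ≤ term z j
  term-nonNeg j z≥0 = *-nonNeg (^-nonNeg j z≥0) (ratio-nonNeg 1 (j !))

  term-+-suc-≤ : ∀ {x y} m → 0ℚ ≤ x → 0ℚ ≤ y → term (x + y) (suc m) ≤ term x (suc m) + y * term (x + y) m
  term-+-suc-≤ {x} {y} m x≥0 y≥0 = begin
    (x + y) ^ suc m * r
      ≤⟨ ℚ.*-monoʳ-≤-nonNeg r {{nonNegative (ratio-nonNeg 1 (suc m !))}} ([x+y]^[1+m]-≤ m x≥0 y≥0) ⟩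
    (x ^ suc m + fromℕ (suc m) * (y * (x + y) ^ m)) * r
      ≡⟨ solve 5 (λ p k y q r → (p :+ k :* (y :* q)) :* r := p :* r :+ y :* (q :* (r :* k)))
                 refl (x ^ suc m) (fromℕ (suc m)) y ((x + y) ^ m) r ⟩
    x ^ suc m * r + y * ((x + y) ^ m * (r * fromℕ (suc m)))
      ≡⟨ cong (λ r′ → x ^ suc m * r + y * ((x + y) ^ m * r′)) (ratio-1-! m) ⟩
    term x (suc m) + y * term (x + y) m ∎
    where
    open ℚ.≤-Reasoning
    open +-*-Solver
    r : ℚ
    r = ratio 1 (suc m !)

  expPartial-mono : ∀ {z} K → 0ℚ ≤ z → expPartial z K ≤ expPartial z (suc K)
  expPartial-mono K z≥0 = sumFrom-≤-suc 0 (suc K) (λ j → term-nonNeg j z≥0)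

  expPartial-+-suc-≤ : ∀ {x y} K → 0ℚ ≤ x → 0ℚ ≤ y →
                       expPartial (x + y) (suc K) ≤ expPartial x (suc K) + y * expPartial (x + y) K
  expPartial-+-suc-≤ {x} {y} K x≥0 y≥0 = ℚ.≤-trans
    (ℚ.+-monoʳ-≤ 1ℚ (sumFrom-shift-≤ 0 (suc K) {term (x + y)} {term x} {term (x + y)} y
      (λ m → term-+-suc-≤ m x≥0 y≥0)))
    (ℚ.≤-reflexive (sym (ℚ.+-assoc 1ℚ (sumFrom 1 (suc K) (term x)) (y * expPartial (x + y) K))))

  expPartial-+-*[1-y]-≤ : ∀ {x y} K → 0ℚ ≤ x → 0ℚ ≤ y → expPartial (x + y) K * (1ℚ - y) ≤ expPartial x K
  expPartial-+-*[1-y]-≤ {x} {y} zero x≥0 y≥0 =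
    ℚ.≤-trans (ℚ.≤-reflexive (ℚ.*-identityˡ (1ℚ - y))) (ℚ.+-monoʳ-≤ 1ℚ (ℚ.neg-antimono-≤ y≥0))
  expPartial-+-*[1-y]-≤ {x} {y} (suc K) x≥0 y≥0 = begin
    E′ * (1ℚ - y)        ≡⟨ solve 2 (λ e y → e :* (con 1ℚ :- y) := e :- y :* e) refl E′ y ⟩
    E′ - y * E′          ≤⟨ ℚ.+-monoˡ-≤ (ℚ.- (y * E′)) (expPartial-+-suc-≤ K x≥0 y≥0) ⟩
    Eₓ + y * E - y * E′  ≤⟨ ℚ.+-monoˡ-≤ (ℚ.- (y * E′)) (ℚ.+-monoʳ-≤ Eₓ
                              (ℚ.*-monoˡ-≤-nonNeg y {{nonNegative y≥0}} (expPartial-mono K (ℚ.+-mono-≤ x≥0 y≥0)))) ⟩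
    Eₓ + y * E′ - y * E′ ≡⟨ solve 2 (λ e w → e :+ w :- w := e) refl Eₓ (y * E′) ⟩
    Eₓ                   ∎
    where
    open ℚ.≤-Reasoning
    open +-*-Solver
    E E′ Eₓ : ℚ
    E  = expPartial (x + y) K
    E′ = expPartial (x + y) (suc K)
    Eₓ = expPartial x (suc K)

  ExpLe-0 : ∀ {q} → 1ℚ ≤ q → ExpLe 0ℚ q
  ExpLe-0 1≤q K = ℚ.≤-trans
    (ℚ.≤-reflexive (trans (cong (1ℚ +_) (sumFrom-suc-zero 0 K term-0-suc)) (ℚ.+-identityʳ 1ℚ))) 1≤q
    where
    term-0-suc : ∀ j → term 0ℚ (suc j) ≡ 0ℚ
    term-0-suc j = trans (cong (_* ratio 1 (suc j !)) (ℚ.*-zeroˡ (0ℚ ^ j))) (ℚ.*-zeroˡ (ratio 1 (suc j !)))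

  ExpLe-+ : ∀ {x y p q} → 0ℚ ≤ x → 0ℚ ≤ y → 0ℚ < 1ℚ - y → ExpLe x p → p ≤ q * (1ℚ - y) → ExpLe (x + y) q
  ExpLe-+ {x} {y} {p} {q} x≥0 y≥0 1-y>0 x≤p p≤q[1-y] K = ℚ.*-cancelʳ-≤-pos (1ℚ - y) {{positive 1-y>0}} (begin
    expPartial (x + y) K * (1ℚ - y) ≤⟨ expPartial-+-*[1-y]-≤ K x≥0 y≥0 ⟩
    expPartial x K                  ≤⟨ x≤p K ⟩
    p                               ≤⟨ p≤q[1-y] ⟩
    q * (1ℚ - y)                    ∎)
    where open ℚ.≤-Reasoning

  p≤q*[1-a*r] : ∀ {n r p q t a} → r * n ≡ 1ℚ → 0ℚ ≤ r → n * p + t ≤ n * q → a * q ≤ t → p ≤ q * (1ℚ - a * r)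
  p≤q*[1-a*r] {n} {r} {p} {q} {t} {a} rn≡1 r≥0 np+t≤nq aq≤t = begin
    p                         ≡⟨ trans (sym (ℚ.*-identityʳ p)) (cong (p *_) (sym rn≡1)) ⟩
    p * (r * n)               ≡⟨ solve 4 (λ p r n t → p :* (r :* n) := (n :* p :+ t :- t) :* r) refl p r n t ⟩
    (n * p + t - t) * r       ≤⟨ ℚ.*-monoʳ-≤-nonNeg r {{nonNegative r≥0}} (ℚ.+-mono-≤ np+t≤nq (ℚ.neg-antimono-≤ aq≤t)) ⟩
    (n * q - a * q) * r       ≡⟨ solve 4 (λ n q a r → (n :* q :- a :* q) :* r := q :* (r :* n) :- q :* (a :* r)) refl n q a r ⟩
    q * (r * n) - q * (a * r) ≡⟨ cong (λ w → q * w - q * (a * r)) rn≡1 ⟩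
    q * 1ℚ - q * (a * r)      ≡⟨ solve 3 (λ q a r → q :* con 1ℚ :- q :* (a :* r) := q :* (con 1ℚ :- a :* r)) refl q a r ⟩
    q * (1ℚ - a * r)          ∎
    where
    open ℚ.≤-Reasoning
    open +-*-Solver

module Counting where
  open import Data.Bool using (Bool; true; false; _∧_; _∨_; not; if_then_else_; T)
  open import Data.Bool.Properties using (T-∨) renaming (_≟_ to _≟ᵇ_)
  open import Data.Bool.ListAction using (and; all)
  open import Data.Nat as ℕ using (ℕ; zero; suc; _+_; _*_; _≤_; _<ᵇ_; z≤n)
  import Data.Nat.Properties as ℕ
  open import Data.Nat.ListAction using (sum)
  open import Data.Nat.ListAction.Properties using (sum-++)
  open import Algebra.Properties.CommutativeSemigroup ℕ.+-commutativeSemigroup using (interchange)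
  open import Data.Rational as ℚ using ()
  import Data.Rational.Properties as ℚ
  open import Data.Fin as Fin using (Fin; toℕ; punchIn; punchOut)
  import Data.Fin.Properties as Fin
  open import Data.Vec.Functional using (_∷_; insertAt)
  open import Data.Vec.Functional.Properties using (insertAt-lookup; insertAt-punchIn)
  open import Data.List as List using (List; []; map; concatMap; filter; length; foldr; allFin; _++_)
  open import Data.List.Properties using (map-cong; map-++; map-∘; length-tabulate)
  open import Data.List.Membership.Propositional using (_∈_; lose; find)
  open import Data.List.Membership.Propositional.Properties
    using (∈-map⁺; ∈-map⁻; ∈-concatMap⁺; ∈-concatMap⁻; ∈-allFin)
  open import Data.List.Relation.Unary.Any using (here; there)
  import Data.List.Relation.Unary.All as All
  open import Data.List.Relation.Unary.All.Properties using (all⁺; all⁻)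
  open import Data.Product using (∃; ∃₂; _×_; _,_)
  open import Data.Sum as Sum using (inj₁; inj₂)
  open import Data.Unit using (tt)
  open import Data.Empty using (⊥-elim)
  open import Function using (_∘_; Congruent; Equivalence)
  open import Relation.Nullary.Decidable using (does; yes; no)
  open import Relation.Binary.Bundles using (TotalPreorder)
  open import Algebra.Core using (Op₂)
  open import Algebra.Definitions using (Selective)
  open import Algebra.Construct.NaturalChoice.Base using (MinOperator)
  import Algebra.Construct.NaturalChoice.MinOp as MinOp
  open import Relation.Binary.PropositionalEquality

  private
    variable
      X Y : Set

  indicator : Bool → ℕ
  indicator true  = 1
  indicator false = 0

  indicator-mono : ∀ {a b} → (T a → T b) → indicator a ≤ indicator b
  indicator-mono {false}         _   = z≤n
  indicator-mono {true}  {true}  _   = ℕ.≤-refl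
  indicator-mono {true}  {false} a⇒b = ⊥-elim (a⇒b tt)

  sum-map-+ : ∀ (f g : X → ℕ) xs → sum (map (λ x → f x + g x) xs) ≡ sum (map f xs) + sum (map g xs)
  sum-map-+ f g []            = refl
  sum-map-+ f g (x List.∷ xs) = trans (cong (f x + g x +_) (sum-map-+ f g xs)) (interchange (f x) (g x) _ _)

  sum-map-++ : ∀ (f : X → ℕ) xs ys → sum (map f (xs ++ ys)) ≡ sum (map f xs) + sum (map f ys)
  sum-map-++ f xs ys = trans (cong sum (map-++ f xs ys)) (sum-++ (map f xs) (map f ys))

  sum-map-const : ∀ k (xs : List X) → sum (map (λ _ → k) xs) ≡ length xs * k
  sum-map-const k []            = refl
  sum-map-const k (x List.∷ xs) = cong (k +_) (sum-map-const k xs)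

  *-sum-map : ∀ k (f : X → ℕ) xs → k * sum (map f xs) ≡ sum (map (λ x → k * f x) xs)
  *-sum-map k f []            = ℕ.*-zeroʳ k
  *-sum-map k f (x List.∷ xs) = trans (ℕ.*-distribˡ-+ k (f x) _) (cong (k * f x +_) (*-sum-map k f xs))

  sum-map-swap : ∀ (f : X → Y → ℕ) xs ys →
                 sum (map (λ x → sum (map (f x) ys)) xs) ≡ sum (map (λ y → sum (map (λ x → f x y) xs)) ys)
  sum-map-swap f []            ys = sym (trans (sum-map-const 0 ys) (ℕ.*-zeroʳ (length ys)))
  sum-map-swap f (x List.∷ xs) ys = trans (cong (sum (map (f x) ys) +_) (sum-map-swap f xs ys))
    (sym (sum-map-+ (f x) (λ y → sum (map (λ x′ → f x′ y) xs)) ys))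

  sum-map-mono-≤ : ∀ {f g : X → ℕ} xs → (∀ x → f x ≤ g x) → sum (map f xs) ≤ sum (map g xs)
  sum-map-mono-≤ []            f≤g = z≤n
  sum-map-mono-≤ (x List.∷ xs) f≤g = ℕ.+-mono-≤ (f≤g x) (sum-map-mono-≤ xs f≤g)

  length-*-≤-sum-map : ∀ k (f : X → ℕ) xs → (∀ x → k ≤ f x) → length xs * k ≤ sum (map f xs)
  length-*-≤-sum-map k f []            k≤f = z≤n
  length-*-≤-sum-map k f (x List.∷ xs) k≤f = ℕ.+-mono-≤ (k≤f x) (length-*-≤-sum-map k f xs k≤f)

  ≤-sum-map : ∀ (f : X → ℕ) {x xs} → x ∈ xs → f x ≤ sum (map f xs)
  ≤-sum-map f                   (here refl) = ℕ.m≤m+n _ _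
  ≤-sum-map f {xs = y List.∷ _} (there x∈)  = ℕ.≤-trans (≤-sum-map f x∈) (ℕ.m≤n+m _ (f y))

  sum-map-filter : ∀ (p : X → Bool) (f : X → ℕ) xs →
                   sum (map f (filter (λ x → p x ≟ᵇ true) xs)) ≡ sum (map (λ x → indicator (p x) * f x) xs)
  sum-map-filter p f []            = refl
  sum-map-filter p f (x List.∷ xs) with p x
  ... | true  = cong₂ _+_ (sym (ℕ.+-identityʳ (f x))) (sum-map-filter p f xs)
  ... | false = sum-map-filter p f xs

  length-filter : ∀ (p : X → Bool) xs → length (filter (λ x → p x ≟ᵇ true) xs) ≡ sum (map (indicator ∘ p) xs)
  length-filter p []            = refl
  length-filter p (x List.∷ xs) with p x
  ... | true  = cong suc (length-filter p xs)
  ... | false = length-filter p xs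

  module _ {a ℓ₁ ℓ₂} {O : TotalPreorder a ℓ₁ ℓ₂} (M : MinOperator O) where
    open TotalPreorder O using (_≲_) renaming (refl to ≲-refl; trans to ≲-trans)
    open MinOperator M using (_⊓_)
    open MinOp M using (x⊓y≤x; x⊓y≤y)

    foldr-⊓-≲ : ∀ {x} y ys → x ∈ y List.∷ ys → foldr _⊓_ y ys ≲ x
    foldr-⊓-≲ y []            (here refl)         = ≲-refl
    foldr-⊓-≲ y (z List.∷ zs) (here refl)         = ≲-trans (x⊓y≤y z _) (foldr-⊓-≲ y zs (here refl))
    foldr-⊓-≲ y (z List.∷ zs) (there (here refl)) = x⊓y≤x z _
    foldr-⊓-≲ y (z List.∷ zs) (there (there x∈)) = ≲-trans (x⊓y≤y z _) (foldr-⊓-≲ y zs (there x∈))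

  foldr-∈ : ∀ (_∙_ : Op₂ X) → Selective _≡_ _∙_ → ∀ y ys → foldr _∙_ y ys ∈ y List.∷ ys
  foldr-∈ _∙_ sel y []            = here refl
  foldr-∈ _∙_ sel y (z List.∷ zs) with sel z (foldr _∙_ y zs)
  ... | inj₁ z∙r≡z = subst (_∈ _) (sym z∙r≡z) (there (here refl))
  ... | inj₂ z∙r≡r = subst (_∈ _) (sym z∙r≡r) (skip (foldr-∈ _∙_ sel y zs))
    where
    skip : ∀ {x} → x ∈ y List.∷ zs → x ∈ y List.∷ z List.∷ zs
    skip (here x≡y) = here x≡y
    skip (there x∈) = there (there x∈)

  minℕ-≤ : ∀ {x xs} → x ∈ xs → minℕ xs ≤ x
  minℕ-≤ {xs = y List.∷ ys} = foldr-⊓-≲ ℕ.⊓-operator y ys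

  minℕ-∈ : ∀ {x xs} → x ∈ xs → minℕ xs ∈ xs
  minℕ-∈ {xs = y List.∷ ys} _ = foldr-∈ ℕ._⊓_ ℕ.⊓-sel y ys

  minℚ-≤ : ∀ {x xs} → x ∈ xs → minℚ xs ℚ.≤ x
  minℚ-≤ {xs = y List.∷ ys} = foldr-⊓-≲ ℚ.⊓-operator y ys

  minℚ-∈ : ∀ {x xs} → x ∈ xs → minℚ xs ∈ xs
  minℚ-∈ {xs = y List.∷ ys} _ = foldr-∈ ℚ._⊓_ ℚ.⊓-sel y ys

  funs-complete : ∀ {bs : List Y} (_≈_ : Y → Y → Set) → (∀ b → ∃ λ b′ → b′ ∈ bs × b′ ≈ b) →
                  ∀ n (f : Fin n → Y) → ∃ λ g → g ∈ funs bs n × (∀ i → g i ≈ f i)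
  funs-complete _≈_ complete zero    f = (λ ()) , here refl , λ ()
  funs-complete _≈_ complete (suc n) f
    with funs-complete _≈_ complete n (f ∘ Fin.suc) | complete (f Fin.zero)
  ... | g , g∈ , g≈ | b , b∈ , b≈ =
    _ , ∈-concatMap⁺ _ (lose b∈ (∈-map⁺ _ g∈)) , λ { Fin.zero → b≈ ; (Fin.suc i) → g≈ i }

  bools-complete : ∀ b → ∃ λ b′ → b′ ∈ bools × b′ ≡ b
  bools-complete true  = true , here refl , refl
  bools-complete false = false , there (here refl) , refl

  allSubsets-complete : ∀ {n} (S : Subset n) → ∃ λ S′ → S′ ∈ allSubsets n × S′ ≗ S
  allSubsets-complete {n} = funs-complete _≡_ bools-complete n

  allColorings-complete : ∀ {n} (c : Coloring n) → ∃ λ c′ → c′ ∈ allColorings n × (∀ i → c′ i ≗ c i)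
  allColorings-complete {n} = funs-complete _ allSubsets-complete n

  Monochromatic : ∀ {n} → Coloring n → Bool → Subset n → Set
  Monochromatic c b S = ∀ {i j} → i Fin.< j → T (S i) → T (S j) → c i j ≡ b

  ∈-if⁺ : ∀ {b} {x : X} → T b → x ∈ (if b then x List.∷ [] else [])
  ∈-if⁺ {b = true} _ = here refl

  ∈-if⁻ : ∀ b {x y : X} → y ∈ (if b then x List.∷ [] else []) → T b × y ≡ x
  ∈-if⁻ true (here y≡x) = tt , y≡x

  edgeIfLess : ∀ {n} → Fin n → Fin n → List (Pair n)
  edgeIfLess i j = if toℕ i <ᵇ toℕ j then pr i j List.∷ [] else []

  edgesFrom : ∀ n → Fin n → List (Pair n)
  edgesFrom n i = concatMap (edgeIfLess i) (allFin n)

  ∈-edges⁺ : ∀ {n} {i j : Fin n} → i Fin.< j → pr i j ∈ edges n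
  ∈-edges⁺ {n} {i} {j} i<j = ∈-concatMap⁺ (edgesFrom n) {allFin n} (lose (∈-allFin i)
    (∈-concatMap⁺ (edgeIfLess i) {allFin n} (lose (∈-allFin j) (∈-if⁺ (ℕ.<⇒<ᵇ i<j)))))

  ∈-edges⁻ : ∀ {n} {e : Pair n} → e ∈ edges n → ∃₂ λ i j → e ≡ pr i j × i Fin.< j
  ∈-edges⁻ {n} e∈ with find (∈-concatMap⁻ (edgesFrom n) {allFin n} e∈)
  ... | i , _ , e∈ᵢ with find (∈-concatMap⁻ (edgeIfLess i) {allFin n} e∈ᵢ)
  ... | j , _ , e∈ᵢⱼ with ∈-if⁻ (toℕ i <ᵇ toℕ j) {pr i j} e∈ᵢⱼ
  ... | i<ᵇj , refl = i , j , refl , ℕ.<ᵇ⇒< (toℕ i) (toℕ j) i<ᵇj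

  all-edges⁻ : ∀ {n} (p : Pair n → Bool) → T (all p (edges n)) → ∀ {i j} → i Fin.< j → T (p (pr i j))
  all-edges⁻ {n} p all-p i<j = All.lookup (all⁺ p (edges n) all-p) (∈-edges⁺ i<j)

  all-edges⁺ : ∀ {n} (p : Pair n → Bool) → (∀ {i j} → i Fin.< j → T (p (pr i j))) → T (all p (edges n))
  all-edges⁺ p p-edges = all⁻ p (All.tabulate (p-edge ∘ ∈-edges⁻))
    where
    p-edge : ∀ {e} → (∃₂ λ i j → e ≡ pr i j × i Fin.< j) → T (p e)
    p-edge (i , j , refl , i<j) = p-edges i<j

  edge-ok⇒ : ∀ {x y z b} → T (not (x ∧ y) ∨ does (z ≟ᵇ b)) → T x → T y → z ≡ b
  edge-ok⇒ {true} {true} {true}  {true}  _ _ _ = refl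
  edge-ok⇒ {true} {true} {false} {false} _ _ _ = refl

  edge-ok⇐ : ∀ x y {z b} → (T x → T y → z ≡ b) → T (not (x ∧ y) ∨ does (z ≟ᵇ b))
  edge-ok⇐ true  true  {z} z≡b with refl ← z≡b tt tt = T-≟-refl {z}
    where
    T-≟-refl : ∀ {b} → T (does (b ≟ᵇ b))
    T-≟-refl {true}  = tt
    T-≟-refl {false} = tt
  edge-ok⇐ true  false z≡b = tt
  edge-ok⇐ false y     z≡b = tt

  monoIn⇒ : ∀ {n} {c : Coloring n} {b S} → T (monoIn c b S) → Monochromatic c b S
  monoIn⇒ mono i<j = edge-ok⇒ (all-edges⁻ _ mono i<j)

  monoIn⇐ : ∀ {n} {c : Coloring n} {b S} → Monochromatic c b S → T (monoIn c b S)
  monoIn⇐ {S = S} mono = all-edges⁺ _ λ {i} {j} i<j → edge-ok⇐ (S i) (S j) (mono i<j)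

  monoIn-cong : ∀ {n} {c c′ : Coloring n} {S S′ : Subset n} b → (∀ i → c i ≗ c′ i) → S ≗ S′ →
                monoIn c b S ≡ monoIn c′ b S′
  monoIn-cong {n} b c≗c′ S≗S′ = cong and (map-cong
    (λ { (pr i j) → cong₂ (λ s z → not s ∨ does (z ≟ᵇ b)) (cong₂ _∧_ (S≗S′ i) (S≗S′ j)) (c≗c′ i j) })
    (edges n))

  isMono-cong : ∀ {n} {c c′ : Coloring n} {S S′ : Subset n} → (∀ i → c i ≗ c′ i) → S ≗ S′ →
                isMono c S ≡ isMono c′ S′
  isMono-cong c≗c′ S≗S′ = cong₂ _∨_ (monoIn-cong true c≗c′ S≗S′) (monoIn-cong false c≗c′ S≗S′)

  isMono-∅ : ∀ {n} (c : Coloring n) → T (isMono c (λ _ → false))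
  isMono-∅ {n} c = Equivalence.from (T-∨ {monoIn c true (λ _ → false)}) (inj₁ (all-edges⁺ {n} _ (λ _ → tt)))

  removeVertex : ∀ {n} → Fin (suc n) → Coloring (suc n) → Coloring n
  removeVertex v c i j = c (punchIn v i) (punchIn v j)

  punchIn-cancel-< : ∀ {n} (v : Fin (suc n)) {i j} → punchIn v i Fin.< punchIn v j → i Fin.< j
  punchIn-cancel-< v {i} {j} v↑i<v↑j = ℕ.≰⇒> λ j≤i → ℕ.<⇒≱ v↑i<v↑j (Fin.punchIn-mono-≤ v j i j≤i)

  T-insertAt-false⇒punchIn : ∀ {n} (S : Subset n) v i → T (insertAt S v false i) →
                             ∃ λ i′ → punchIn v i′ ≡ i × T (S i′)
  T-insertAt-false⇒punchIn S v i Sᵢ with v Fin.≟ i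
  ... | yes refl = ⊥-elim (subst T (insertAt-lookup S v false) Sᵢ)
  ... | no v≢i   = punchOut v≢i , Fin.punchIn-punchOut v≢i ,
    subst T (trans (cong (insertAt S v false) (sym (Fin.punchIn-punchOut v≢i))) (insertAt-punchIn S v false _)) Sᵢ

  monoIn-removeVertex : ∀ {n} v (c : Coloring (suc n)) {b S} →
                        T (monoIn (removeVertex v c) b S) → T (monoIn c b (insertAt S v false))
  monoIn-removeVertex v c {b} {S} mono = monoIn⇐ mono′
    where
    mono′ : Monochromatic c b (insertAt S v false)
    mono′ {i} {j} i<j Sᵢ Sⱼ with T-insertAt-false⇒punchIn S v i Sᵢ | T-insertAt-false⇒punchIn S v j Sⱼ
    ... | i′ , refl , S′ᵢ | j′ , refl , S′ⱼ = monoIn⇒ mono (punchIn-cancel-< v i<j) S′ᵢ S′ⱼ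

  isMono-removeVertex : ∀ {n} v (c : Coloring (suc n)) {S} →
                        T (isMono (removeVertex v c) S) → T (isMono c (insertAt S v false))
  isMono-removeVertex v c =
    Equivalence.from T-∨ ∘ Sum.map (monoIn-removeVertex v c) (monoIn-removeVertex v c) ∘ Equivalence.to T-∨

  insertAt-cong : ∀ {n} {xs ys : Fin n → X} i x → xs ≗ ys → insertAt xs i x ≗ insertAt ys i x
  insertAt-cong             Fin.zero    x xs≗ys Fin.zero    = refl
  insertAt-cong             Fin.zero    x xs≗ys (Fin.suc j) = xs≗ys j
  insertAt-cong {n = suc n} (Fin.suc i) x xs≗ys Fin.zero    = xs≗ys Fin.zero
  insertAt-cong {n = suc n} (Fin.suc i) x xs≗ys (Fin.suc j) = insertAt-cong i x (xs≗ys ∘ Fin.suc) j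

  sumSubsets : ∀ {n} → (Subset n → ℕ) → ℕ
  sumSubsets {n} f = sum (map f (allSubsets n))

  -- allSubsets prepends a bit with a pattern lambda that agrees with (b ∷_) only pointwise,
  -- hence the congruence hypothesis here and below.
  sumSubsets-suc : ∀ {n} (f : Subset (suc n) → ℕ) → Congruent _≗_ _≡_ f →
                   sumSubsets f ≡ sumSubsets (f ∘ (true ∷_)) + sumSubsets (f ∘ (false ∷_))
  sumSubsets-suc {n} f f-cong =
    split _ _ (λ S → λ { Fin.zero → refl ; (Fin.suc i) → refl }) (λ S → λ { Fin.zero → refl ; (Fin.suc i) → refl })
    where
    prepend : ∀ b (φ : Subset n → Subset (suc n)) → (∀ S → φ S ≗ b ∷ S) →
              sum (map f (map φ (allSubsets n))) ≡ sumSubsets (f ∘ (b ∷_))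
    prepend b φ φ≗ = trans (cong sum (sym (map-∘ (allSubsets n)))) (cong sum (map-cong (f-cong ∘ φ≗) (allSubsets n)))
    split : ∀ φₜ φ𝒻 → (∀ S → φₜ S ≗ true ∷ S) → (∀ S → φ𝒻 S ≗ false ∷ S) →
            sum (map f (map φₜ (allSubsets n) ++ (map φ𝒻 (allSubsets n) ++ []))) ≡
            sumSubsets (f ∘ (true ∷_)) + sumSubsets (f ∘ (false ∷_))
    split φₜ φ𝒻 φₜ≗ φ𝒻≗ = trans (sum-map-++ f (map φₜ (allSubsets n)) _) (cong₂ _+_ (prepend true φₜ φₜ≗)
      (trans (sum-map-++ f (map φ𝒻 (allSubsets n)) []) (trans (ℕ.+-identityʳ _) (prepend false φ𝒻 φ𝒻≗))))

  sumSubsets-avoiding : ∀ {n} v (f : Subset (suc n) → ℕ) → Congruent _≗_ _≡_ f →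
                        sumSubsets (λ S → f S * indicator (not (S v))) ≡ sumSubsets (λ S → f (insertAt S v false))
  sumSubsets-avoiding {n} Fin.zero f f-cong = begin
    sumSubsets (λ S → f S * indicator (not (S Fin.zero)))
      ≡⟨ sumSubsets-suc _ (λ S≗S′ → cong₂ _*_ (f-cong S≗S′) (cong (indicator ∘ not) (S≗S′ Fin.zero))) ⟩
    sumSubsets (λ S → f (true ∷ S) * 0) + sumSubsets (λ S → f (false ∷ S) * 1)
      ≡⟨ cong₂ _+_
           (trans (cong sum (map-cong (ℕ.*-zeroʳ ∘ f ∘ (true ∷_)) (allSubsets n))) (sum-map-const 0 (allSubsets n)))
           (cong sum (map-cong (λ S → trans (ℕ.*-identityʳ _) (f-cong (false∷≗insertAt S))) (allSubsets n))) ⟩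
    length (allSubsets n) * 0 + sumSubsets (λ S → f (insertAt S Fin.zero false))
      ≡⟨ cong (_+ sumSubsets (λ S → f (insertAt S Fin.zero false))) (ℕ.*-zeroʳ (length (allSubsets n))) ⟩
    sumSubsets (λ S → f (insertAt S Fin.zero false)) ∎
    where
    open ≡-Reasoning
    false∷≗insertAt : ∀ S → false ∷ S ≗ insertAt S Fin.zero false
    false∷≗insertAt S Fin.zero    = refl
    false∷≗insertAt S (Fin.suc i) = refl
  sumSubsets-avoiding {suc n} (Fin.suc v) f f-cong = begin
    sumSubsets (λ S → f S * indicator (not (S (Fin.suc v))))
      ≡⟨ sumSubsets-suc _ (λ S≗S′ → cong₂ _*_ (f-cong S≗S′) (cong (indicator ∘ not) (S≗S′ (Fin.suc v)))) ⟩
    sumSubsets (λ S → f (true ∷ S) * indicator (not (S v))) + sumSubsets (λ S → f (false ∷ S) * indicator (not (S v)))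
      ≡⟨ cong₂ _+_ (sumSubsets-avoiding v (f ∘ (true ∷_)) (∷-cong true))
                   (sumSubsets-avoiding v (f ∘ (false ∷_)) (∷-cong false)) ⟩
    sumSubsets (λ S → f (true ∷ insertAt S v false)) + sumSubsets (λ S → f (false ∷ insertAt S v false))
      ≡⟨ cong₂ _+_ (insertAt-∷ true) (insertAt-∷ false) ⟨
    sumSubsets (λ S → f (insertAt (true ∷ S) (Fin.suc v) false))
      + sumSubsets (λ S → f (insertAt (false ∷ S) (Fin.suc v) false))
      ≡⟨ sumSubsets-suc _ (λ S≗S′ → f-cong (insertAt-cong (Fin.suc v) false S≗S′)) ⟨
    sumSubsets (λ S → f (insertAt S (Fin.suc v) false)) ∎
    where
    open ≡-Reasoning
    ∷-cong : ∀ b → Congruent _≗_ _≡_ (f ∘ (b ∷_))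
    ∷-cong b S≗S′ = f-cong λ { Fin.zero → refl ; (Fin.suc i) → S≗S′ i }
    insertAt-∷ : ∀ b → sumSubsets (λ S → f (insertAt (b ∷ S) (Fin.suc v) false)) ≡
                       sumSubsets (λ S → f (b ∷ insertAt S v false))
    insertAt-∷ b = cong sum (map-cong (λ S → f-cong λ { Fin.zero → refl ; (Fin.suc i) → refl }) (allSubsets n))

  monoIndicator : ∀ {n} → Coloring n → Subset n → ℕ
  monoIndicator c S = indicator (isMono c S)

  monoIndicator-cong : ∀ {n} (c : Coloring n) → Congruent _≗_ _≡_ (monoIndicator c)
  monoIndicator-cong c S≗S′ = cong indicator (isMono-cong (λ _ _ → refl) S≗S′)

  numMono-sum : ∀ {n} (c : Coloring n) → numMono c ≡ sumSubsets (monoIndicator c)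
  numMono-sum {n} c = length-filter (isMono c) (allSubsets n)

  totalMono-sum : ∀ {n} (c : Coloring n) → totalMono c ≡ sumSubsets (λ S → monoIndicator c S * size S)
  totalMono-sum {n} c = sum-map-filter (isMono c) size (allSubsets n)

  coSize : ∀ {n} → Subset n → ℕ
  coSize {n} S = sum (map (λ v → indicator (not (S v))) (allFin n))

  size-+-coSize : ∀ {n} (S : Subset n) → size S + coSize S ≡ n
  size-+-coSize {n} S = begin
    size S + coSize S                                                    ≡⟨ cong (_+ coSize S) (length-filter S (allFin n)) ⟩
    sum (map (indicator ∘ S) (allFin n)) + coSize S                      ≡⟨ sum-map-+ (indicator ∘ S) _ (allFin n) ⟨
    sum (map (λ v → indicator (S v) + indicator (not (S v))) (allFin n)) ≡⟨ cong sum (map-cong (indicator-+-not ∘ S) (allFin n)) ⟩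
    sum (map (λ _ → 1) (allFin n))                                       ≡⟨ sum-map-const 1 (allFin n) ⟩
    length (allFin n) * 1                                                ≡⟨ ℕ.*-identityʳ _ ⟩
    length (allFin n)                                                    ≡⟨ length-tabulate (λ i → i) ⟩
    n                                                                    ∎
    where
    open ≡-Reasoning
    indicator-+-not : ∀ b → indicator b + indicator (not b) ≡ 1
    indicator-+-not true  = refl
    indicator-+-not false = refl

  monoAvoiding : ∀ {n} → Coloring n → Fin n → ℕ
  monoAvoiding c v = sumSubsets (λ S → monoIndicator c S * indicator (not (S v)))

  double-counting : ∀ {n} (c : Coloring n) → n * numMono c ≡ totalMono c + sum (map (monoAvoiding c) (allFin n))
  double-counting {n} c = begin
    n * numMono c
      ≡⟨ cong (n *_) (numMono-sum c) ⟩
    n * sumSubsets (monoIndicator c)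
      ≡⟨ *-sum-map n (monoIndicator c) (allSubsets n) ⟩
    sumSubsets (λ S → n * monoIndicator c S)
      ≡⟨ cong sum (map-cong split (allSubsets n)) ⟩
    sumSubsets (λ S → monoIndicator c S * size S + sum (map (avoids S) (allFin n)))
      ≡⟨ sum-map-+ (λ S → monoIndicator c S * size S) _ (allSubsets n) ⟩
    sumSubsets (λ S → monoIndicator c S * size S) + sumSubsets (λ S → sum (map (avoids S) (allFin n)))
      ≡⟨ cong₂ _+_ (totalMono-sum c) (sym (sum-map-swap avoids (allSubsets n) (allFin n))) ⟨
    totalMono c + sum (map (monoAvoiding c) (allFin n)) ∎
    where
    open ≡-Reasoning
    avoids : Subset n → Fin n → ℕ
    avoids S v = monoIndicator c S * indicator (not (S v))
    split : ∀ S → n * monoIndicator c S ≡ monoIndicator c S * size S + sum (map (avoids S) (allFin n))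
    split S = begin
      n * m                    ≡⟨ ℕ.*-comm n m ⟩
      m * n                    ≡⟨ cong (m *_) (size-+-coSize S) ⟨
      m * (size S + coSize S)  ≡⟨ ℕ.*-distribˡ-+ m (size S) (coSize S) ⟩
      m * size S + m * coSize S ≡⟨ cong (m * size S +_) (*-sum-map m _ (allFin n)) ⟩
      m * size S + sum (map (avoids S) (allFin n)) ∎
      where
      m : ℕ
      m = monoIndicator c S

  numMono-removeVertex-≤ : ∀ {n} v (c : Coloring (suc n)) → numMono (removeVertex v c) ≤ monoAvoiding c v
  numMono-removeVertex-≤ {n} v c = begin
    numMono (removeVertex v c)
      ≡⟨ numMono-sum (removeVertex v c) ⟩
    sumSubsets (monoIndicator (removeVertex v c))
      ≤⟨ sum-map-mono-≤ (allSubsets n) (λ S → indicator-mono (isMono-removeVertex v c)) ⟩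
    sumSubsets (λ S → monoIndicator c (insertAt S v false))
      ≡⟨ sumSubsets-avoiding v (monoIndicator c) (monoIndicator-cong c) ⟨
    monoAvoiding c v ∎
    where open ℕ.≤-Reasoning

  numMono-cong : ∀ {n} {c c′ : Coloring n} → (∀ i → c i ≗ c′ i) → numMono c ≡ numMono c′
  numMono-cong {n} {c} {c′} c≗c′ = trans (numMono-sum c) (trans
    (cong sum (map-cong (λ S → cong indicator (isMono-cong c≗c′ λ _ → refl)) (allSubsets n)))
    (sym (numMono-sum c′)))

  numMono-pos : ∀ {n} (c : Coloring n) → 1 ≤ numMono c
  numMono-pos {n} c with allSubsets-complete {n} (λ _ → false)
  ... | ∅ , ∅∈ , ∅≗ = begin
    1                            ≤⟨ indicator-mono {true} (λ _ → subst T (isMono-cong (λ _ _ → refl) (sym ∘ ∅≗)) (isMono-∅ c)) ⟩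
    monoIndicator c ∅            ≤⟨ ≤-sum-map (monoIndicator c) ∅∈ ⟩
    sumSubsets (monoIndicator c) ≡⟨ numMono-sum c ⟨
    numMono c                    ∎
    where open ℕ.≤-Reasoning

  C-≤ : ∀ {n} (c : Coloring n) → C n ≤ numMono c
  C-≤ c with allColorings-complete c
  ... | c′ , c′∈ , c′≗c = ℕ.≤-trans (minℕ-≤ (∈-map⁺ numMono c′∈)) (ℕ.≤-reflexive (numMono-cong c′≗c))

  C-attained : ∀ n → ∃ λ c → c ∈ allColorings n × C n ≡ numMono c
  C-attained n with allColorings-complete {n} (λ _ _ → true)
  ... | c₀ , c₀∈ , _ = ∈-map⁻ numMono (minℕ-∈ (∈-map⁺ numMono c₀∈))

  C-pos : ∀ n → 1 ≤ C n
  C-pos n with C-attained n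
  ... | c , _ , C≡numMono = ℕ.≤-trans (numMono-pos c) (ℕ.≤-reflexive (sym C≡numMono))

  A-≤ : ∀ {n} {c : Coloring n} → c ∈ allColorings n → A n ℚ.≤ avgMono c
  A-≤ c∈ = minℚ-≤ (∈-map⁺ avgMono c∈)

  A-attained : ∀ n → ∃ λ c → c ∈ allColorings n × A n ≡ avgMono c
  A-attained n with allColorings-complete {n} (λ _ _ → true)
  ... | c₀ , c₀∈ , _ = ∈-map⁻ avgMono (minℚ-∈ (∈-map⁺ avgMono c₀∈))

  *-C-+-totalMono≤*-numMono : ∀ m (c : Coloring (suc m)) → suc m * C m + totalMono c ≤ suc m * numMono c
  *-C-+-totalMono≤*-numMono m c = begin
    suc m * C m + totalMono c
      ≡⟨ ℕ.+-comm (suc m * C m) (totalMono c) ⟩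
    totalMono c + suc m * C m
      ≡⟨ cong (λ k → totalMono c + k * C m) (length-tabulate {n = suc m} (λ i → i)) ⟨
    totalMono c + length (allFin (suc m)) * C m
      ≤⟨ ℕ.+-monoʳ-≤ (totalMono c) (length-*-≤-sum-map (C m) (monoAvoiding c) (allFin (suc m))
           λ v → ℕ.≤-trans (C-≤ (removeVertex v c)) (numMono-removeVertex-≤ v c)) ⟩
    totalMono c + sum (map (monoAvoiding c) (allFin (suc m)))
      ≡⟨ double-counting c ⟨
    suc m * numMono c ∎
    where open ℕ.≤-Reasoning

open ExpBounds
open Counting
open import Data.Nat as ℕ using (ℕ; zero; suc; _≤_)
import Data.Nat.Properties as ℕ
open import Data.Rational as ℚ using (0ℚ; 1ℚ)
import Data.Rational.Properties as ℚ
open import Data.List.Membership.Propositional using (_∈_)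
open import Data.Product using (_,_)
open import Function using (_∘_)
open import Relation.Binary.PropositionalEquality

A-nonNeg : ∀ n → 0ℚ ℚ.≤ A n
A-nonNeg n =
  let c , _ , A≡avgMono = A-attained n
  in subst (0ℚ ℚ.≤_) (sym A≡avgMono) (ratio-nonNeg (totalMono c) (numMono c))

S-nonNeg : ∀ n → 0ℚ ℚ.≤ S n
S-nonNeg n = sumFrom-nonNeg 2 (n ℕ.∸ 1) λ i → *-nonNeg (A-nonNeg i) (ratio-nonNeg 1 i)

ExpLe-numMono : ∀ m {c : Coloring (suc (suc m))} → c ∈ allColorings (suc (suc m)) →
                ExpLe (S (suc m)) (fromℕ (C (suc m))) → ExpLe (S (suc (suc m))) (fromℕ (numMono c))
ExpLe-numMono m {c} c∈ IH = subst (λ x → ExpLe x N) (sym (sumFrom-snoc 2 m _))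
  (ExpLe-+ (S-nonNeg (suc m)) y≥0 1-y>0 IH P≤N[1-y])
  where
  n : ℕ
  n = suc (suc m)
  y P N : ℚ.ℚ
  y = A n ℚ.* ratio 1 n
  P = fromℕ (C (suc m))
  N = fromℕ (numMono c)
  y≥0 : 0ℚ ℚ.≤ y
  y≥0 = *-nonNeg (A-nonNeg n) (ratio-nonNeg 1 n)
  counting : fromℕ n ℚ.* P ℚ.+ fromℕ (totalMono c) ℚ.≤ fromℕ n ℚ.* N
  counting = subst₂ ℚ._≤_
    (trans (fromℕ-+ (n ℕ.* C (suc m)) (totalMono c)) (cong (ℚ._+ fromℕ (totalMono c)) (fromℕ-* n (C (suc m)))))
    (fromℕ-* n (numMono c))
    (fromℕ-mono-≤ (*-C-+-totalMono≤*-numMono (suc m) c))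
  averaging : A n ℚ.* N ℚ.≤ fromℕ (totalMono c)
  averaging = ℚ.≤-trans (ℚ.*-monoʳ-≤-nonNeg N {{ℚ.nonNegative (fromℕ-nonNeg (numMono c))}} (A-≤ c∈))
    (ℚ.≤-reflexive (ratio-*-cancel (totalMono c) (numMono c) {{ℕ.>-nonZero (numMono-pos c)}}))
  -- The implicit arguments are explicit because unification would otherwise unfold A n,
  -- which enumerates all colourings.
  P≤N[1-y] : P ℚ.≤ N ℚ.* (1ℚ ℚ.- y)
  P≤N[1-y] = p≤q*[1-a*r] {fromℕ n} {ratio 1 n} {P} {N} {fromℕ (totalMono c)} {A n}
    (ratio-*-cancel 1 n) (ratio-nonNeg 1 n) counting averaging
  1-y>0 : 0ℚ ℚ.< 1ℚ ℚ.- y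
  1-y>0 = ℚ.*-cancelˡ-<-nonNeg N {{ℚ.nonNegative (fromℕ-nonNeg (numMono c))}}
    (ℚ.<-≤-trans (subst (ℚ._< P) (sym (ℚ.*-zeroʳ N)) (fromℕ-pos (C (suc m)) {{ℕ.>-nonZero (C-pos (suc m))}}))
      P≤N[1-y])

ExpLe-C : ∀ m → ExpLe (S (suc m)) (fromℕ (C (suc m)))
-- S 1 is the empty sum 0ℚ.
ExpLe-C zero    = ExpLe-0 (fromℕ-mono-≤ (C-pos 1))
ExpLe-C (suc m) =
  let c , c∈ , C≡numMono = C-attained (suc (suc m))
  in subst (ExpLe (S (suc (suc m))) ∘ fromℕ) (sym C≡numMono) (ExpLe-numMono m c∈ (ExpLe-C m))

mainTheorem19 : (n : ℕ) → 2 ≤ n → ExpLe (S n) (fromℕ (C n))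
mainTheorem19 (suc m) _ = ExpLe-C m
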